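{- Let $\mathcal A$ be an algebra. (1) If an $\mathcal A$-stable preorder $\preceq$ is sp-residually finite then its associated congruence $\sim=\{(x,y):x\preceq y, y\preceq x\}$ is c-residually finite. (2) An $\mathcal A$-congruence is c-residually finite if and only if, viewed as a stable preorder, it is sp-residually finite. In particular, every sp-residually finite algebra is c-residually finite.
   Context: For an algebra $\mathcal A$, congruences are equivalence relations compatible with all operations, stable preorders are reflexive transitive relations compatible with all operations. The index of a congruence is its number of classes; the index of a stable preorder is that of its associated congruence. A congruence is c-residually finite if it is the intersection of a family of finite index congruences; a stable preorder is sp-residually finite if it is the intersection of a family of finite index stable preorders. An algebra is c-residually finite (resp. sp-residually finite) if all its congruences (resp. stable preorders) are c-residually finite (resp. sp-residually finite). -}

module Defs where

open import Data.Nat using (ℕ)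
open import Data.Fin using (Fin)
open import Data.Product using (Σ; _×_)
open import Relation.Binary.Core using (Rel)
open import Relation.Binary.Definitions using (Reflexive; Symmetric; Transitive)

record Algebra : Set₁ where
  field
    Op      : Set
    arity   : Op → ℕ
    Carrier : Set
    ⟦_⟧     : (f : Op) → (Fin (arity f) → Carrier) → Carrier

module _ (𝒜 : Algebra) where
  open Algebra 𝒜

  BinRel : Set₁
  BinRel = Rel Carrier _

  Compatible : BinRel → Set
  Compatible R = ∀ (f : Op) (xs ys : Fin (arity f) → Carrier) →
                 (∀ i → R (xs i) (ys i)) → R (⟦ f ⟧ xs) (⟦ f ⟧ ys)

  IsCongruence : BinRel → Set
  IsCongruence R = Reflexive R × Symmetric R × Transitive R × Compatible R

  IsStablePreorder : BinRel → Set
  IsStablePreorder R = Reflexive R × Transitive R × Compatible R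

  Assoc : BinRel → BinRel
  Assoc R x y = R x y × R y x

  -- an equivalence relation has finite index: finitely many classes, i.e.
  -- finitely many representatives such that every element is related to one
  FiniteIndexCong : BinRel → Set
  FiniteIndexCong R = Σ ℕ λ n → Σ (Fin n → Carrier) λ rep →
                      ∀ x → Σ (Fin n) λ i → R x (rep i)

  FiniteIndexSP : BinRel → Set
  FiniteIndexSP R = FiniteIndexCong (Assoc R)

  IsIntersection : BinRel → {I : Set} → (I → BinRel) → Set
  IsIntersection R {I} Rs = ∀ x y → (R x y → ∀ i → Rs i x y) × ((∀ i → Rs i x y) → R x y)

  CResiduallyFinite : BinRel → Set₁
  CResiduallyFinite R = Σ Set λ I → Σ (I → BinRel) λ Rs →
    (∀ i → IsCongruence (Rs i) × FiniteIndexCong (Rs i)) × IsIntersection R Rs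

  SPResiduallyFinite : BinRel → Set₁
  SPResiduallyFinite R = Σ Set λ I → Σ (I → BinRel) λ Rs →
    (∀ i → IsStablePreorder (Rs i) × FiniteIndexSP (Rs i)) × IsIntersection R Rs

  AlgCResiduallyFinite : Set₁
  AlgCResiduallyFinite = ∀ R → IsCongruence R → CResiduallyFinite R

  AlgSPResiduallyFinite : Set₁
  AlgSPResiduallyFinite = ∀ R → IsStablePreorder R → SPResiduallyFinite R

{-# OPTIONS --safe #-}
-- Taking associated congruences commutes with intersections, and the associated
-- congruence of a finite-index stable preorder has finite index by the very
-- definition of the index of a preorder; so an sp-residual approximation of ≼
-- yields a c-residual approximation of ∼. Conversely a finite-index congruence
-- is a finite-index stable preorder, and a symmetric relation coincides with its
-- associated congruence.
module Submission where

open import Defs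
open import Data.Product using (_×_; _,_; proj₁; proj₂; map₂)
open import Function using (_∘_)
open import Relation.Binary.Core using (_⇒_; _⇔_)
open import Relation.Binary.Definitions using (Symmetric)

module _ (𝒜 : Algebra) where
  open Algebra 𝒜

  private
    variable
      R S : BinRel 𝒜
      I : Set
      Rs : I → BinRel 𝒜

  congruence⇒stablePreorder : IsCongruence 𝒜 R → IsStablePreorder 𝒜 R
  congruence⇒stablePreorder (refl , _ , trans , compat) = refl , trans , compat

  Assoc-isCongruence : IsStablePreorder 𝒜 R → IsCongruence 𝒜 (Assoc 𝒜 R)
  Assoc-isCongruence (refl , trans , compat) =
    (refl , refl) ,
    (λ (xy , yx) → yx , xy) ,
    (λ (xy , yx) (yz , zy) → trans xy yz , trans zy yx) ,
    (λ f xs ys xs∼ys → compat f xs ys (proj₁ ∘ xs∼ys) , compat f ys xs (proj₂ ∘ xs∼ys))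

  Assoc⇒ : Assoc 𝒜 R ⇒ R
  Assoc⇒ = proj₁

  symmetric⇒⇒Assoc : Symmetric R → R ⇒ Assoc 𝒜 R
  symmetric⇒⇒Assoc sym r = r , sym r

  finiteIndexCong-mono : R ⇒ S → FiniteIndexCong 𝒜 R → FiniteIndexCong 𝒜 S
  finiteIndexCong-mono R⇒S (n , rep , classOf) = n , rep , map₂ R⇒S ∘ classOf

  isIntersection-Assoc : IsIntersection 𝒜 R Rs → IsIntersection 𝒜 (Assoc 𝒜 R) (Assoc 𝒜 ∘ Rs)
  isIntersection-Assoc R≡⋂Rs x y =
    (λ (xy , yx) i → proj₁ (R≡⋂Rs x y) xy i , proj₁ (R≡⋂Rs y x) yx i) ,
    (λ ∀xy → proj₂ (R≡⋂Rs x y) (proj₁ ∘ ∀xy) , proj₂ (R≡⋂Rs y x) (proj₂ ∘ ∀xy))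

  isIntersection-resp-⇔ : R ⇔ S → IsIntersection 𝒜 R Rs → IsIntersection 𝒜 S Rs
  isIntersection-resp-⇔ (R⇒S , S⇒R) R≡⋂Rs x y =
    proj₁ (R≡⋂Rs x y) ∘ S⇒R , R⇒S ∘ proj₂ (R≡⋂Rs x y)

  cResiduallyFinite-resp-⇔ : R ⇔ S → CResiduallyFinite 𝒜 R → CResiduallyFinite 𝒜 S
  cResiduallyFinite-resp-⇔ R⇔S (I , Rs , finite , R≡⋂Rs) =
    I , Rs , finite , isIntersection-resp-⇔ R⇔S R≡⋂Rs

  Assoc-cResiduallyFinite : SPResiduallyFinite 𝒜 R → CResiduallyFinite 𝒜 (Assoc 𝒜 R)
  Assoc-cResiduallyFinite (I , Rs , finite , R≡⋂Rs) =
    I , Assoc 𝒜 ∘ Rs ,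
    (λ i → Assoc-isCongruence (proj₁ (finite i)) , proj₂ (finite i)) ,
    isIntersection-Assoc R≡⋂Rs

  finiteIndexCong⇒finiteIndexSP : Symmetric R → FiniteIndexCong 𝒜 R → FiniteIndexSP 𝒜 R
  finiteIndexCong⇒finiteIndexSP {R} sym =
    finiteIndexCong-mono {S = Assoc 𝒜 R} (symmetric⇒⇒Assoc {R} sym)

  finiteIndexCongruence⇒finiteIndexStablePreorder :
    IsCongruence 𝒜 R × FiniteIndexCong 𝒜 R → IsStablePreorder 𝒜 R × FiniteIndexSP 𝒜 R
  finiteIndexCongruence⇒finiteIndexStablePreorder (isCong@(_ , sym , _) , finiteIndex) =
    congruence⇒stablePreorder isCong , finiteIndexCong⇒finiteIndexSP sym finiteIndex

  cResiduallyFinite⇒spResiduallyFinite : CResiduallyFinite 𝒜 R → SPResiduallyFinite 𝒜 R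
  cResiduallyFinite⇒spResiduallyFinite (I , Rs , finite , R≡⋂Rs) =
    I , Rs , finiteIndexCongruence⇒finiteIndexStablePreorder ∘ finite , R≡⋂Rs

  spResiduallyFinite⇒cResiduallyFinite :
    Symmetric R → SPResiduallyFinite 𝒜 R → CResiduallyFinite 𝒜 R
  spResiduallyFinite⇒cResiduallyFinite {R} sym =
    cResiduallyFinite-resp-⇔ {R = Assoc 𝒜 R} (Assoc⇒ {R} , symmetric⇒⇒Assoc {R} sym)
    ∘ Assoc-cResiduallyFinite

lemma5p10 : (𝒜 : Defs.Algebra) →
    ((R : BinRel 𝒜) → IsStablePreorder 𝒜 R → SPResiduallyFinite 𝒜 R →
        CResiduallyFinite 𝒜 (Assoc 𝒜 R))
    × ((R : BinRel 𝒜) → IsCongruence 𝒜 R →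
        (CResiduallyFinite 𝒜 R → SPResiduallyFinite 𝒜 R)
        × (SPResiduallyFinite 𝒜 R → CResiduallyFinite 𝒜 R))
    × (AlgSPResiduallyFinite 𝒜 → AlgCResiduallyFinite 𝒜)
lemma5p10 𝒜 =
  (λ _ _ → Assoc-cResiduallyFinite 𝒜) ,
  (λ _ (_ , sym , _) →
    cResiduallyFinite⇒spResiduallyFinite 𝒜 , spResiduallyFinite⇒cResiduallyFinite 𝒜 sym) ,
  (λ spRF R isCong@(_ , sym , _) →
    spResiduallyFinite⇒cResiduallyFinite 𝒜 sym (spRF R (congruence⇒stablePreorder 𝒜 isCong)))
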